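{- For each integer $b \geq 2$ and each $k \in \mathbb{Z}^+$, there exist $k$ consecutive non-negative integers $c$ such that, for each of them, the function $S_{[c,b]}:\mathbb{Z}^+\to\mathbb{Z}^+$ defined by $S_{[c,b]}\left(\sum_{i=0}^n a_i b^i\right) = c + \sum_{i=0}^n a_i^2$ (base $b$ expansion, $0\le a_i\le b-1$, $a_n\ne0$) has no fixed point (i.e., there exists a $k$-desert base $b$).
   Context: A fixed point of $S_{[c,b]}$ is a positive integer $a$ with $S_{[c,b]}(a)=a$. A $k$-desert base $b$ is a set of $k$ consecutive non-negative integers $c$ for each of which $S_{[c,b]}$ has no fixed points. -}

module Defs where

open import Data.Nat using (ℕ; zero; suc; _+_; _*_; _≤_; _<_; NonZero)
open import Data.Nat.DivMod using (_/_; _%_)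
open import Data.Product using (∃-syntax; _×_)
open import Relation.Binary.PropositionalEquality using (_≡_)
open import Relation.Nullary using (¬_)

-- Sum of the squares of the base-b digits of a, computed with a fuel
-- parameter (fuel ≥ number of digits suffices; fuel = a always suffices
-- for b ≥ 2 since each step divides by b).
sqDigitSumFuel : (fuel b : ℕ) → .{{NonZero b}} → ℕ → ℕ
sqDigitSumFuel zero     b a = 0
sqDigitSumFuel (suc f)  b zero = 0
sqDigitSumFuel (suc f)  b a@(suc _) =
  (a % b) * (a % b) + sqDigitSumFuel f b (a / b)

sqDigitSum : (b : ℕ) → .{{NonZero b}} → ℕ → ℕ
sqDigitSum b a = sqDigitSumFuel a b a

S : (c b : ℕ) → .{{NonZero b}} → ℕ → ℕ
S c b a = c + sqDigitSum b a

IsFixedPoint : (c b : ℕ) → .{{NonZero b}} → ℕ → Set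
IsFixedPoint c b a = 1 ≤ a × S c b a ≡ a

HasNoFixedPoint : (c b : ℕ) → .{{NonZero b}} → Set
HasNoFixedPoint c b = ∀ a → ¬ IsFixedPoint c b a

IsDesert : (k b : ℕ) → .{{NonZero b}} → ℕ → Set
IsDesert k b c₀ = ∀ i → i < k → HasNoFixedPoint (c₀ + i) b

2≤⇒nonZero : ∀ {b} → 2 ≤ b → NonZero b
2≤⇒nonZero (Data.Nat.s≤s _) = _

{-# OPTIONS --safe #-}

-- Write sq(a) for the sum of the squared base-b digits of a, so that a is a
-- fixed point of S_[c,b] exactly when c = a − sq(a).  Numbers just below b^n
-- have many top digits equal to b − 1, hence a large sq(a), while numbers
-- a ≥ b^n satisfy sq(a) ≤ a − b^n + 1 + b².  Take M = b^m and n = m + M.  A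
-- fixed point a of S_c with c ≥ b^n − M is at least b^n: otherwise its top M
-- digits are all b − 1, so sq(a) ≥ M and a = c + sq(a) ≥ b^n.  Hence
-- c ≥ b^n − 1 − b², and every c in [b^n − M, b^n − M + k) is fixed-point free
-- as soon as M > k + b², which holds for m = k + b² + 1.
module Submission where

open import Data.Nat
open import Data.Nat.Properties
open import Data.Nat.DivMod
open import Data.Nat.Divisibility using (n∣m*n)
open import Data.Nat.Tactic.RingSolver using (solve-∀)
open import Data.Product using (∃-syntax; _,_)
open import Relation.Binary.PropositionalEquality
open import Relation.Nullary using (yes; no)

open import Defs

n<m^n : ∀ {m} → 1 < m → ∀ n → n < m ^ n
n<m^n 1<m zero    = s≤s z≤n
n<m^n 1<m (suc n) = ≤-<-trans (n<m^n 1<m n) (^-monoʳ-< _ 1<m (n<1+n n))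

*-cancel-digitʳ-≤ : ∀ {n} r x y → r < n → x * n ≤ r + y * n → x ≤ y
*-cancel-digitʳ-≤ {n} r x y r<n le =
  ≤-pred (*-cancelʳ-< n x (suc y) (≤-<-trans le (+-monoˡ-< (y * n) r<n)))

*-cancel-digitʳ-< : ∀ {n} r x y → r + y * n < x * n → y < x
*-cancel-digitʳ-< {n} r x y lt = *-cancelʳ-< n y x (≤-<-trans (m≤n+m (y * n) r) lt)

0<m<n⇒m*m+n≤m*n+1 : ∀ {m n} → 0 < m → m < n → m * m + n ≤ m * n + 1
0<m<n⇒m*m+n≤m*n+1 {suc s} _ m<n with m≤n⇒∃[o]m+o≡n m<n
... | u , refl = subst (suc s * suc s + (2 + s + u) ≤_) (identity s u) (m≤m+n _ (s * u))
  where
  identity : ∀ s u → suc s * suc s + (2 + s + u) + s * u ≡ suc s * (2 + s + u) + 1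
  identity = solve-∀

s+p≤q+1⇒s+[1+n]*p≤[1+n]*q+1 : ∀ n {s p q} → 1 ≤ s → s + p ≤ q + 1 →
                              s + suc n * p ≤ suc n * q + 1
s+p≤q+1⇒s+[1+n]*p≤[1+n]*q+1 n {s} {p} {q} 1≤s le = +-cancelʳ-≤ n _ _ (begin
  s + suc n * p + n      ≤⟨ +-monoʳ-≤ (s + suc n * p) n≤n*s ⟩
  s + suc n * p + n * s  ≡⟨ left n s p ⟩
  suc n * (s + p)        ≤⟨ *-monoʳ-≤ (suc n) le ⟩
  suc n * (q + 1)        ≡⟨ right n q ⟩
  suc n * q + 1 + n      ∎)
  where
  open ≤-Reasoning
  left : ∀ n s p → s + suc n * p + n * s ≡ suc n * (s + p)
  left = solve-∀
  right : ∀ n q → suc n * (q + 1) ≡ suc n * q + 1 + n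
  right = solve-∀
  n≤n*s : n ≤ n * s
  n≤n*s = subst (_≤ n * s) (*-identityʳ n) (*-monoʳ-≤ n 1≤s)

module Base (e : ℕ) where

  b : ℕ
  b = 2 + e

  b-1 : ℕ
  b-1 = 1 + e

  1<b : 1 < b
  1<b = s≤s (s≤s z≤n)

  sq : ℕ → ℕ
  sq = sqDigitSum b

  sqDigitSumFuel-irrelevant : ∀ f g a → a ≤ f → a ≤ g →
                              sqDigitSumFuel f b a ≡ sqDigitSumFuel g b a
  sqDigitSumFuel-irrelevant zero    zero    a       _       _       = refl
  sqDigitSumFuel-irrelevant zero    (suc g) zero    _       _       = refl
  sqDigitSumFuel-irrelevant (suc f) zero    zero    _       _       = refl
  sqDigitSumFuel-irrelevant (suc f) (suc g) zero    _       _       = refl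
  sqDigitSumFuel-irrelevant (suc f) (suc g) (suc a) (s≤s p) (s≤s q) =
    cong (suc a % b * (suc a % b) +_)
      (sqDigitSumFuel-irrelevant f g (suc a / b) (≤-trans a/b≤ p) (≤-trans a/b≤ q))
    where
    a/b≤ : suc a / b ≤ a
    a/b≤ = ≤-pred (m/n<m (suc a) b 1<b)

  sq-unfold : ∀ a → sq a ≡ a % b * (a % b) + sq (a / b)
  sq-unfold zero    = refl
  sq-unfold (suc a) = cong (suc a % b * (suc a % b) +_)
    (sqDigitSumFuel-irrelevant a (suc a / b) (suc a / b) (≤-pred (m/n<m (suc a) b 1<b)) ≤-refl)

  sq-step : ∀ r q → r < b → sq (r + q * b) ≡ r * r + sq q
  sq-step r q r<b = begin
    sq (r + q * b)                              ≡⟨ sq-unfold (r + q * b) ⟩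
    digit * digit + sq ((r + q * b) / b)        ≡⟨ cong₂ (λ x y → x * x + sq y) digit≡r quotient≡q ⟩
    r * r + sq q                                ∎
    where
    open ≡-Reasoning
    digit : ℕ
    digit = (r + q * b) % b
    digit≡r : digit ≡ r
    digit≡r = trans ([m+kn]%n≡m%n r q b) (m<n⇒m%n≡m r<b)
    quotient≡q : (r + q * b) / b ≡ q
    quotient≡q = trans (+-distrib-/-∣ʳ r (n∣m*n q)) (cong₂ _+_ (m<n⇒m/n≡0 r<b) (m*n/n≡m q b))

  data LastDigit : ℕ → Set where
    split : ∀ r q → r < b → LastDigit (r + q * b)

  lastDigit : ∀ a → LastDigit a
  lastDigit a = subst LastDigit (sym (m≡m%n+[m/n]*n a b)) (split (a % b) (a / b) (m%n<n a b))

  -- Recursion on the fuel is structural, recursion on a ↦ a / b is not.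
  sqDigitSumFuel≤*b-1 : ∀ f a → sqDigitSumFuel f b a ≤ a * b-1
  sqDigitSumFuel≤*b-1 zero    a         = z≤n
  sqDigitSumFuel≤*b-1 (suc f) zero      = z≤n
  sqDigitSumFuel≤*b-1 (suc f) a@(suc _) = begin
    r * r + sqDigitSumFuel f b q  ≤⟨ +-mono-≤ (*-monoʳ-≤ r (≤-pred (m%n<n a b)))
                                      (≤-trans (sqDigitSumFuel≤*b-1 f q) (*-monoˡ-≤ b-1 (m≤m*n q b))) ⟩
    r * b-1 + q * b * b-1         ≡⟨ *-distribʳ-+ b-1 r (q * b) ⟨
    (r + q * b) * b-1             ≡⟨ cong (_* b-1) (m≡m%n+[m/n]*n a b) ⟨
    a * b-1                       ∎
    where
    open ≤-Reasoning
    r q : ℕ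
    r = a % b
    q = a / b

  sqDigitSumFuel-pos : ∀ f a → a ≤ f → 0 < a → 0 < sqDigitSumFuel f b a
  sqDigitSumFuel-pos (suc f) a@(suc _) (s≤s a≤f) _ with a / b in eq
  ... | zero  = ≤-trans (*-mono-≤ 0<r 0<r) (m≤m+n (a % b * (a % b)) _)
    where
    0<r : 0 < a % b
    0<r = subst (0 <_) (sym (m<n⇒m%n≡m (m/n≡0⇒m<n {a} {b} eq))) z<s
  ... | suc q = ≤-trans (sqDigitSumFuel-pos f (suc q) q≤f z<s) (m≤n+m _ _)
    where
    q≤f : suc q ≤ f
    q≤f = subst (_≤ f) eq (≤-trans (≤-pred (m/n<m a b 1<b)) a≤f)

  sq≤*b-1 : ∀ a → sq a ≤ a * b-1
  sq≤*b-1 a = sqDigitSumFuel≤*b-1 a a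

  sq-pos : ∀ a → 0 < a → 0 < sq a
  sq-pos a = sqDigitSumFuel-pos a a ≤-refl

  sq+b≤*b+1 : ∀ a → 0 < a → sq a + b ≤ a * b + 1
  sq+b≤*b+1 a 0<a with lastDigit a
  ... | split r zero r<b rewrite sq-step r zero r<b | +-identityʳ (r * r) | +-identityʳ r =
    0<m<n⇒m*m+n≤m*n+1 0<a r<b
  ... | split r q@(suc _) r<b = begin
    sq (r + q * b) + b              ≡⟨ cong (_+ b) (sq-step r q r<b) ⟩
    r * r + sq q + b                ≤⟨ +-mono-≤ (+-mono-≤ (*-monoʳ-≤ r (<⇒≤ r<b))
                                         (≤-trans (sq≤*b-1 q) (*-monoˡ-≤ b-1 (m≤m*n q b))))
                                         (m≤n*m b q) ⟩
    r * b + q * b * b-1 + q * b     ≡⟨ identity e r (q * b) ⟩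
    (r + q * b) * b                 ≤⟨ m≤m+n _ 1 ⟩
    (r + q * b) * b + 1             ∎
    where
    open ≤-Reasoning
    identity : ∀ e r x → r * (2 + e) + x * (1 + e) + x ≡ (r + x) * (2 + e)
    identity = solve-∀

  b^j≤a⇒sq+b^[1+j]≤*b+1 : ∀ j a → b ^ j ≤ a → sq a + b ^ suc j ≤ a * b + 1
  b^j≤a⇒sq+b^[1+j]≤*b+1 zero a 0<a rewrite *-identityʳ b = sq+b≤*b+1 a 0<a
  b^j≤a⇒sq+b^[1+j]≤*b+1 (suc j) a b^[1+j]≤a with lastDigit a
  ... | split r q r<b = begin
    sq (r + q * b) + b * P          ≡⟨ cong (_+ b * P) (sq-step r q r<b) ⟩
    r * r + sq q + b * P            ≡⟨ +-assoc (r * r) (sq q) (b * P) ⟩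
    r * r + (sq q + b * P)          ≤⟨ +-mono-≤ (*-monoʳ-≤ r (<⇒≤ r<b))
                                         (s+p≤q+1⇒s+[1+n]*p≤[1+n]*q+1 b-1 (sq-pos q 0<q) IH) ⟩
    r * b + (b * (q * b) + 1)       ≡⟨ identity e r q ⟩
    (r + q * b) * b + 1             ∎
    where
    open ≤-Reasoning
    P : ℕ
    P = b ^ suc j
    b^j≤q : b ^ j ≤ q
    b^j≤q = *-cancel-digitʳ-≤ r (b ^ j) q r<b (subst (_≤ r + q * b) (*-comm b (b ^ j)) b^[1+j]≤a)
    0<q : 0 < q
    0<q = ≤-trans (m^n>0 b j) b^j≤q
    IH : sq q + P ≤ q * b + 1
    IH = b^j≤a⇒sq+b^[1+j]≤*b+1 j q b^j≤q
    identity : ∀ e r q → r * (2 + e) + ((2 + e) * (q * (2 + e)) + 1) ≡ (r + q * (2 + e)) * (2 + e) + 1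
    identity = solve-∀

  b^[1+j]≤a⇒sq+b^[1+j]≤a+1+b*b : ∀ j a → b ^ suc j ≤ a → sq a + b ^ suc j ≤ a + 1 + b * b
  b^[1+j]≤a⇒sq+b^[1+j]≤a+1+b*b j a b^[1+j]≤a with lastDigit a
  ... | split r q r<b = begin
    sq (r + q * b) + b ^ suc j       ≡⟨ cong (_+ b ^ suc j) (sq-step r q r<b) ⟩
    r * r + sq q + b ^ suc j         ≡⟨ +-assoc (r * r) (sq q) (b ^ suc j) ⟩
    r * r + (sq q + b ^ suc j)       ≤⟨ +-mono-≤ r*r≤r+b*b (b^j≤a⇒sq+b^[1+j]≤*b+1 j q b^j≤q) ⟩
    (r + b * b) + (q * b + 1)        ≡⟨ identity r (q * b) (b * b) ⟩
    r + q * b + 1 + b * b            ∎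
    where
    open ≤-Reasoning
    b^j≤q : b ^ j ≤ q
    b^j≤q = *-cancel-digitʳ-≤ r (b ^ j) q r<b (subst (_≤ r + q * b) (*-comm b (b ^ j)) b^[1+j]≤a)
    r*r≤r+b*b : r * r ≤ r + b * b
    r*r≤r+b*b = ≤-trans (*-mono-≤ (<⇒≤ r<b) (<⇒≤ r<b)) (m≤n+m (b * b) r)
    identity : ∀ r x y → (r + y) + (x + 1) ≡ r + x + 1 + y
    identity = solve-∀

  -- If a ∈ [b^(m+t) − b^m, b^(m+t)), the t digits of a above the lowest m
  -- all equal b − 1.
  sq-topDigits : ∀ m t a → b ^ (m + t) ≤ a + b ^ m → a < b ^ (m + t) → t * (b-1 * b-1) ≤ sq a
  sq-topDigits zero zero a _ _ = z≤n
  sq-topDigits zero (suc t) a le lt with lastDigit a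
  ... | split r q r<b = subst (suc t * (b-1 * b-1) ≤_) (sym (sq-step r q r<b))
                          (+-mono-≤ (*-mono-≤ b-1≤r b-1≤r) (sq-topDigits zero t q b^t≤q+1 q<b^t))
    where
    le′ : b ^ t * b ≤ suc r + q * b
    le′ = subst₂ _≤_ (*-comm b (b ^ t)) (+-comm (r + q * b) 1) le
    q<b^t : q < b ^ t
    q<b^t = *-cancel-digitʳ-< r (b ^ t) q (subst (r + q * b <_) (*-comm b (b ^ t)) lt)
    b^t≤q+1 : b ^ t ≤ q + 1
    b^t≤q+1 = subst (b ^ t ≤_) (+-comm 1 q)
      (*-cancelʳ-≤ (b ^ t) (suc q) b (≤-trans le′ (+-monoˡ-≤ (q * b) r<b)))
    b-1≤r : b-1 ≤ r
    b-1≤r = ≤-pred (+-cancelʳ-≤ (q * b) b (suc r) (≤-trans (*-monoˡ-≤ b q<b^t) le′))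
  sq-topDigits (suc m) t a le lt with lastDigit a
  ... | split r q r<b = subst (t * (b-1 * b-1) ≤_) (sym (sq-step r q r<b))
                          (≤-trans (sq-topDigits m t q b^[m+t]≤q+b^m q<b^[m+t]) (m≤n+m _ (r * r)))
    where
    q<b^[m+t] : q < b ^ (m + t)
    q<b^[m+t] = *-cancel-digitʳ-< r (b ^ (m + t)) q (subst (r + q * b <_) (*-comm b (b ^ (m + t))) lt)
    b^[m+t]≤q+b^m : b ^ (m + t) ≤ q + b ^ m
    b^[m+t]≤q+b^m = *-cancel-digitʳ-≤ r (b ^ (m + t)) (q + b ^ m) r<b
      (subst₂ _≤_ (*-comm b (b ^ (m + t))) (identity e r q (b ^ m)) le)
      where
      identity : ∀ e r q p → r + q * (2 + e) + (2 + e) * p ≡ r + (q + p) * (2 + e)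
      identity = solve-∀

  fixedPoint≥b^[m+b^m] : ∀ m c a → b ^ (m + b ^ m) ≤ c + b ^ m → c + sq a ≡ a →
                         b ^ (m + b ^ m) ≤ a
  fixedPoint≥b^[m+b^m] m c a le fix with a <? b ^ (m + b ^ m)
  ... | no  a≮ = ≮⇒≥ a≮
  ... | yes a< = begin
    b ^ (m + b ^ m)  ≤⟨ le ⟩
    c + b ^ m        ≤⟨ +-monoʳ-≤ c b^m≤sq ⟩
    c + sq a         ≡⟨ fix ⟩
    a                ∎
    where
    open ≤-Reasoning
    le′ : b ^ (m + b ^ m) ≤ a + b ^ m
    le′ = ≤-trans le (+-monoˡ-≤ (b ^ m) (subst (c ≤_) fix (m≤m+n c (sq a))))
    b^m≤sq : b ^ m ≤ sq a
    b^m≤sq = ≤-trans (m≤m*n (b ^ m) (b-1 * b-1)) (sq-topDigits m (b ^ m) a le′ a<)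

  b^[1+j]≤fixedPoint⇒b^[1+j]≤c+1+b*b : ∀ j c a → b ^ suc j ≤ a → c + sq a ≡ a →
                                       b ^ suc j ≤ c + 1 + b * b
  b^[1+j]≤fixedPoint⇒b^[1+j]≤c+1+b*b j c a b^[1+j]≤a fix = +-cancelˡ-≤ (sq a) _ _ (begin
    sq a + b ^ suc j        ≤⟨ b^[1+j]≤a⇒sq+b^[1+j]≤a+1+b*b j a b^[1+j]≤a ⟩
    a + 1 + b * b           ≡⟨ cong (λ x → x + 1 + b * b) fix ⟨
    c + sq a + 1 + b * b    ≡⟨ identity c (sq a) (b * b) ⟩
    sq a + (c + 1 + b * b)  ∎)
    where
    open ≤-Reasoning
    identity : ∀ c s y → c + s + 1 + y ≡ s + (c + 1 + y)
    identity = solve-∀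

  desert : ∀ k → ∃[ c₀ ] IsDesert k b c₀
  desert k = c₀ , no-fixedPoint
    where
    m M c₀ : ℕ
    m = suc (k + b * b)
    M = b ^ m
    c₀ = b ^ (m + M) ∸ M
    c₀+M≡b^[m+M] : c₀ + M ≡ b ^ (m + M)
    c₀+M≡b^[m+M] = m∸n+n≡m (^-monoʳ-≤ b (m≤m+n m M))
    no-fixedPoint : IsDesert k b c₀
    no-fixedPoint i i<k a (_ , fix) = <⇒≱ (<-trans i+1+b*b<m (n<m^n 1<b m)) M≤i+1+b*b
      where
      b^[m+M]≤a : b ^ (m + M) ≤ a
      b^[m+M]≤a = fixedPoint≥b^[m+b^m] m (c₀ + i) a
        (subst (_≤ c₀ + i + M) c₀+M≡b^[m+M] (+-monoˡ-≤ M (m≤m+n c₀ i))) fix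
      reassociate : c₀ + i + 1 + b * b ≡ c₀ + (i + 1 + b * b)
      reassociate = trans (cong (_+ b * b) (+-assoc c₀ i 1)) (+-assoc c₀ (i + 1) (b * b))
      M≤i+1+b*b : M ≤ i + 1 + b * b
      M≤i+1+b*b = +-cancelˡ-≤ c₀ _ _ (subst₂ _≤_ (sym c₀+M≡b^[m+M]) reassociate
        (b^[1+j]≤fixedPoint⇒b^[1+j]≤c+1+b*b (k + b * b + M) (c₀ + i) a b^[m+M]≤a fix))
      i+1+b*b<m : i + 1 + b * b < m
      i+1+b*b<m = s≤s (+-monoˡ-≤ (b * b) (subst (_≤ k) (+-comm 1 i) i<k))

theorem4p4 : (b : ℕ) → (2≤b : 2 ≤ b) → (k : ℕ) → 1 ≤ k →
    ∃[ c₀ ] IsDesert k b {{2≤⇒nonZero 2≤b}} c₀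
theorem4p4 (suc (suc e)) (s≤s (s≤s z≤n)) k _ = Base.desert e k
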